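{- Let $M=(E,\mathcal L)$ be a nearly finitary matroid that is not $n$-nearly finitary for any natural number $n$, and let $T$ be a set of coloops of $M$. Then the contraction $M/T$ is a nearly finitary matroid that is not $n$-nearly finitary for any natural number $n$.
   Context: A matroid is a pair $M=(E,\mathcal L)$, where $E$ is a possibly infinite set and $\mathcal L\subseteq 2^E$ satisfies: (I1) $\emptyset\in\mathcal L$; (I2) if $B\in\mathcal L$ and $A\subseteq B$ then $A\in\mathcal L$; (I3) if $B$ is a maximal element of $\mathcal L$ and $A\in\mathcal L$ is not maximal, then there is $b\in B\setminus A$ with $A\cup\{b\}\in\mathcal L$; (I4) if $A\in\mathcal L$ and $A\subseteq X\subseteq E$, then $\{S\in\mathcal L: A\subseteq S\subseteq X\}$ has a maximal element. Maximal independent sets are bases. A coloop is an element contained in every base. The dual is $M^*=(E,\{S: S\subseteq E\setminus B\text{ for some base }B\})$; the restriction to $X\subseteq E$ is $M|X=(X,\mathcal L\cap 2^X)$; the contraction by $T$ is $M/T=(M^*|(E\setminus T))^*$. The finitarization is $M^{\mathrm{fin}}=(E,\mathcal L^{\mathrm{fin}})$, where $S\in\mathcal L^{\mathrm{fin}}$ iff every finite subset of $S$ is in $\mathcal L$. $M$ is nearly finitary if whenever $F$ is a base of $M^{\mathrm{fin}}$, $B$ is a base of $M$ and $B\subseteq F$, the set $F\setminus B$ is finite; $M$ is $n$-nearly finitary if in this situation always $|F\setminus B|\le n$. -}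

module Defs where

open import Level using (Level) renaming (suc to lsuc; zero to lzero)
open import Data.Nat using (ℕ; _≤_)
open import Data.List using (List; length)
open import Data.List.Membership.Propositional using (_∈_)
open import Data.Product using (Σ; _×_; _,_)
open import Data.Sum using (_⊎_)
open import Data.Empty using (⊥)
open import Relation.Nullary using (¬_)
open import Relation.Binary.PropositionalEquality using (_≡_)

-- All matroids live on subsets of a fixed ambient type U.
-- A subset of U is a predicate U → Set.
Subset : Set → Set₁
Subset U = U → Set

module _ {U : Set} where

  _⊆_ : Subset U → Subset U → Set
  A ⊆ B = ∀ x → A x → B x

  ∅ : Subset U
  ∅ _ = ⊥

  _∪_ : Subset U → Subset U → Subset U
  (A ∪ B) x = A x ⊎ B x

  _∩_ : Subset U → Subset U → Subset U
  (A ∩ B) x = A x × B x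

  _∖_ : Subset U → Subset U → Subset U
  (A ∖ B) x = A x × ¬ B x

  ｛_｝ : U → Subset U
  ｛ b ｝ x = x ≡ b

  Finite : Subset U → Set
  Finite S = Σ (List U) λ xs → ∀ x → S x → x ∈ xs

  AtMost : ℕ → Subset U → Set
  AtMost n S = Σ (List U) λ xs → length xs ≤ n × (∀ x → S x → x ∈ xs)

record SetSystem (U : Set) : Set₂ where
  constructor ⟨_,_⟩
  field
    E : Subset U
    Ind : Subset U → Set₁

open SetSystem public

module _ {U : Set} where

  IsMaximal : (Subset U → Set₁) → Subset U → Set₁
  IsMaximal P A = P A × (∀ B → P B → A ⊆ B → B ⊆ A)

  Base : SetSystem U → Subset U → Set₁
  Base M = IsMaximal (Ind M)

  record IsMatroid (M : SetSystem U) : Set₂ where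
    field
      Ind⊆E : ∀ A → Ind M A → A ⊆ E M
      I1 : Ind M ∅
      I2 : ∀ A B → Ind M B → A ⊆ B → Ind M A
      I3 : ∀ A B → Base M B → Ind M A → ¬ Base M A →
           Σ U λ b → (B ∖ A) b × Ind M (A ∪ ｛ b ｝)
      I4 : ∀ A X → Ind M A → A ⊆ X → X ⊆ E M →
           Σ (Subset U) λ S →
             IsMaximal (λ S′ → Ind M S′ × (A ⊆ S′ × S′ ⊆ X)) S

  IsColoop : SetSystem U → U → Set₁
  IsColoop M e = E M e × (∀ B → Base M B → B e)

  dual : SetSystem U → SetSystem U
  dual M = ⟨ E M , (λ S → S ⊆ E M × Σ (Subset U) λ B → Base M B × S ⊆ (E M ∖ B)) ⟩

  restrict : SetSystem U → Subset U → SetSystem U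
  restrict M X = ⟨ X , (λ S → Ind M S × S ⊆ X) ⟩

  contract : SetSystem U → Subset U → SetSystem U
  contract M T = dual (restrict (dual M) (E M ∖ T))

  finitarization : SetSystem U → SetSystem U
  finitarization M =
    ⟨ E M , (λ S → S ⊆ E M × (∀ F → F ⊆ S → Finite F → Ind M F)) ⟩

  NearlyFinitary : SetSystem U → Set₁
  NearlyFinitary M = ∀ F B → Base (finitarization M) F → Base M B → B ⊆ F →
                     Finite (F ∖ B)

  NNearlyFinitary : ℕ → SetSystem U → Set₁
  NNearlyFinitary n M = ∀ F B → Base (finitarization M) F → Base M B → B ⊆ F →
                        AtMost n (F ∖ B)

module Submission where

-- The whole argument rests on one description: when T consists of coloops,
-- a set is independent in M/T exactly when it is independent in M and avoids T
-- (contract-Ind⇒, contract-Ind⇐).  The same description then holds for the finitarizations.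
-- In that situation a general principle (module BaseTransfer) says that
-- S ↦ S ∪ T and S ↦ S ∖ T exchange the maximal members of the two families;
-- so bases of M/T are the sets B ∖ T for bases B of M, and likewise for the
-- finitarizations.  The matroid axioms for M/T are read off from those of M
-- through this correspondence, and the differences F ∖ B between a base of the
-- finitarization and a base contained in it do not change when T is added or
-- removed.  Hence a finite bound on these differences in M gives one in M/T,
-- and an n-bound in M/T would give an n-bound in M, which is impossible.
-- Complements and maximality arguments are classical, so excluded middle is
-- assumed throughout, as in the theorem's hypotheses.

open import Defs
open import Level using (lift; lower) renaming (suc to lsuc; zero to lzero)
open import Axiom.ExcludedMiddle using (ExcludedMiddle)
open import Data.Nat using (ℕ)
open import Data.Product using (_×_; _,_; proj₁; proj₂; Σ)
open import Data.Sum using (inj₁; inj₂)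
open import Data.Empty using (⊥-elim)
open import Relation.Nullary using (¬_; Dec; yes; no)
open import Relation.Nullary.Decidable using (map′; decidable-stable)
open import Relation.Binary.PropositionalEquality using (refl)

module Classical (em : ExcludedMiddle (lsuc lzero)) where

  decide : (P : Set) → Dec P
  decide P = map′ lower lift em

  byContradiction : {P : Set} → ¬ ¬ P → P
  byContradiction {P} = decidable-stable (decide P)

  ⊆-∖-∪ : {U : Set} (T X : Subset U) → X ⊆ ((X ∖ T) ∪ T)
  ⊆-∖-∪ T X x x∈X with decide (T x)
  ... | yes t = inj₂ t
  ... | no ¬t = inj₁ (x∈X , ¬t)

module _ {U : Set} where

  Finite-mono : {A B : Subset U} → A ⊆ B → Finite B → Finite A
  Finite-mono A⊆B (xs , cover) = xs , λ x a → cover x (A⊆B x a)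

  AtMost-mono : {n : ℕ} {A B : Subset U} → A ⊆ B → AtMost n B → AtMost n A
  AtMost-mono A⊆B (xs , len , cover) = xs , len , λ x a → cover x (A⊆B x a)

  IsMaximal-resp : {P : Subset U → Set₁} {A A′ : Subset U} →
                   A ⊆ A′ → A′ ⊆ A → P A → IsMaximal P A′ → IsMaximal P A
  IsMaximal-resp A⊆A′ A′⊆A PA (_ , max) =
    PA , λ C PC A⊆C x x∈C → A′⊆A x (max C PC (λ y y∈A′ → A⊆C y (A′⊆A y y∈A′)) x x∈C)

  finInd-down : (M : SetSystem U) (A B : Subset U) →
                Ind (finitarization M) B → A ⊆ B → Ind (finitarization M) A
  finInd-down M A B (B⊆E , finite⇒ind) A⊆B =
    (λ x a → B⊆E x (A⊆B x a)) ,
    λ F F⊆A finF → finite⇒ind F (λ x f → A⊆B x (F⊆A x f)) finF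

module BaseTransfer (em : ExcludedMiddle (lsuc lzero)) {U : Set} (E T : Subset U)
  (P Q : Subset U → Set₁)
  (P-down : ∀ A B → P B → A ⊆ B → P A)
  (P⊆E : ∀ A → P A → A ⊆ E)
  (P-∪T : ∀ A → P A → P (A ∪ T))
  (Q⇒P : ∀ S → Q S → P S × S ⊆ (E ∖ T))
  (P⇒Q : ∀ S → P S × S ⊆ (E ∖ T) → Q S) where
  open Classical em

  P-∖T : ∀ A → P A → Q (A ∖ T)
  P-∖T A PA = P⇒Q _ (P-down _ A PA (λ _ → proj₁) , λ y p → P⊆E A PA y (proj₁ p) , proj₂ p)

  maximal-∪T : ∀ B′ → IsMaximal Q B′ → IsMaximal P (B′ ∪ T)
  maximal-∪T B′ (QB′ , max) = P-∪T B′ PB′ , bounded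
    where
    PB′ : P B′
    PB′ = proj₁ (Q⇒P B′ QB′)
    B′⊆E∖T : B′ ⊆ (E ∖ T)
    B′⊆E∖T = proj₂ (Q⇒P B′ QB′)
    bounded : ∀ C → P C → (B′ ∪ T) ⊆ C → C ⊆ (B′ ∪ T)
    bounded C PC B′∪T⊆C x x∈C with ⊆-∖-∪ T C x x∈C
    ... | inj₂ t = inj₂ t
    ... | inj₁ x∈C∖T = inj₁ (max (C ∖ T) (P-∖T C PC) B′⊆C∖T x x∈C∖T)
      where
      B′⊆C∖T : B′ ⊆ (C ∖ T)
      B′⊆C∖T y b = B′∪T⊆C y (inj₁ b) , proj₂ (B′⊆E∖T y b)

  maximal-∖T : ∀ B → IsMaximal P B → IsMaximal Q (B ∖ T)
  maximal-∖T B (PB , max) = P-∖T B PB , bounded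
    where
    bounded : ∀ C → Q C → (B ∖ T) ⊆ C → C ⊆ (B ∖ T)
    bounded C QC B∖T⊆C x x∈C =
      max (C ∪ T) (P-∪T C (proj₁ (Q⇒P C QC))) B⊆C∪T x (inj₁ x∈C) ,
      proj₂ (proj₂ (Q⇒P C QC) x x∈C)
      where
      B⊆C∪T : B ⊆ (C ∪ T)
      B⊆C∪T y b with ⊆-∖-∪ T B y b
      ... | inj₁ y∈B∖T = inj₁ (B∖T⊆C y y∈B∖T)
      ... | inj₂ t = inj₂ t

-- Axiom (I4) with X = E: every independent set extends to a base.
extendToBase : {U : Set} {M : SetSystem U} → IsMatroid M →
               ∀ S → Ind M S → Σ (Subset U) λ B → Base M B × S ⊆ B
extendToBase {M = M} mat S indS
  with IsMatroid.I4 mat S (E M) indS (IsMatroid.Ind⊆E mat S indS) (λ _ e → e)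
... | B , (indB , S⊆B , _) , max =
  B , (indB , λ C indC B⊆C → max C (indC , (λ x s → B⊆C x (S⊆B x s)) , IsMatroid.Ind⊆E mat C indC) B⊆C) ,
  S⊆B

module ColoopContraction (em : ExcludedMiddle (lsuc lzero)) {U : Set}
  (M : SetSystem U) (T : Subset U)
  (mat : IsMatroid M) (coloop : ∀ e → T e → IsColoop M e) where
  open IsMatroid mat
  open Classical em

  C : SetSystem U
  C = contract M T

  R : SetSystem U
  R = restrict (dual M) (E M ∖ T)

  -- every base contains T, so adjoining T keeps a set independent
  Ind-∪T : ∀ S → Ind M S → Ind M (S ∪ T)
  Ind-∪T S indS with extendToBase mat S indS
  ... | B , baseB , S⊆B = I2 (S ∪ T) B (proj₁ baseB) S∪T⊆B
    where
    S∪T⊆B : (S ∪ T) ⊆ B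
    S∪T⊆B x (inj₁ s) = S⊆B x s
    S∪T⊆B x (inj₂ t) = proj₂ (coloop x t) B baseB

  complement-Ind : ∀ B → Base M B → Ind R (E M ∖ B)
  complement-Ind B baseB =
    ((λ _ → proj₁) , B , baseB , λ _ p → p) ,
    λ y p → proj₁ p , λ t → proj₂ p (proj₂ (coloop y t) B baseB)

  -- ... and even a base of it: a larger independent set avoids a base B₂ ⊆ B,
  -- and B₂ = B by maximality of B₂
  complement-Base : ∀ B → Base M B → Base R (E M ∖ B)
  complement-Base B baseB = complement-Ind B baseB , bounded
    where
    bounded : ∀ D → Ind R D → (E M ∖ B) ⊆ D → D ⊆ (E M ∖ B)
    bounded D ((D⊆E , B₂ , baseB₂ , D⊆E∖B₂) , _) E∖B⊆D y y∈D =
      D⊆E y y∈D , λ y∈B → proj₂ (D⊆E∖B₂ y y∈D) (B⊆B₂ y y∈B)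
      where
      B₂⊆B : B₂ ⊆ B
      B₂⊆B z z∈B₂ = byContradiction λ z∉B →
        proj₂ (D⊆E∖B₂ z (E∖B⊆D z (Ind⊆E B₂ (proj₁ baseB₂) z z∈B₂ , z∉B))) z∈B₂
      B⊆B₂ : B ⊆ B₂
      B⊆B₂ = proj₂ baseB₂ B (proj₁ baseB) B₂⊆B

  contract-Ind⇒ : ∀ S → Ind C S → Ind M S × S ⊆ (E M ∖ T)
  contract-Ind⇒ S (S⊆E∖T , B′ , ((((_ , B , baseB , B′⊆E∖B)) , _) , maxB′) , S⊆E∖T∖B′) =
    I2 S B (proj₁ baseB) S⊆B , S⊆E∖T
    where
    -- an element of S outside B would lie in E ∖ B = B′, which S avoids
    S⊆B : S ⊆ B
    S⊆B x x∈S = byContradiction λ x∉B →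
      proj₂ (S⊆E∖T∖B′ x x∈S)
            (maxB′ (E M ∖ B) (complement-Ind B baseB) B′⊆E∖B x (proj₁ (S⊆E∖T x x∈S) , x∉B))

  contract-Ind⇐ : ∀ S → Ind M S × S ⊆ (E M ∖ T) → Ind C S
  contract-Ind⇐ S (indS , S⊆E∖T) with extendToBase mat S indS
  ... | B , baseB , S⊆B =
    S⊆E∖T , (E M ∖ B) , complement-Base B baseB ,
    λ x x∈S → S⊆E∖T x x∈S , λ x∈E∖B → proj₂ x∈E∖B (S⊆B x x∈S)

  finInd-∪T : ∀ A → Ind (finitarization M) A → Ind (finitarization M) (A ∪ T)
  finInd-∪T A (A⊆E , finite⇒ind) = A∪T⊆E , finite⇒indep
    where
    A∪T⊆E : (A ∪ T) ⊆ E M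
    A∪T⊆E x (inj₁ a) = A⊆E x a
    A∪T⊆E x (inj₂ t) = proj₁ (coloop x t)
    -- a finite F ⊆ A ∪ T lies in (F ∖ T) ∪ T, where F ∖ T is a finite subset of A
    finite⇒indep : ∀ F → F ⊆ (A ∪ T) → Finite F → Ind M F
    finite⇒indep F F⊆A∪T finF =
      I2 F ((F ∖ T) ∪ T)
         (Ind-∪T (F ∖ T) (finite⇒ind (F ∖ T) F∖T⊆A (Finite-mono (λ _ → proj₁) finF)))
         (⊆-∖-∪ T F)
      where
      F∖T⊆A : (F ∖ T) ⊆ A
      F∖T⊆A x (f , ¬t) with F⊆A∪T x f
      ... | inj₁ a = a
      ... | inj₂ t = ⊥-elim (¬t t)

  contract-finInd⇒ : ∀ S → Ind (finitarization C) S →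
                     Ind (finitarization M) S × S ⊆ (E M ∖ T)
  contract-finInd⇒ S (S⊆E∖T , finite⇒ind) =
    ((λ x s → proj₁ (S⊆E∖T x s)) , λ F F⊆S finF → proj₁ (contract-Ind⇒ F (finite⇒ind F F⊆S finF))) ,
    S⊆E∖T

  contract-finInd⇐ : ∀ S → Ind (finitarization M) S × S ⊆ (E M ∖ T) →
                     Ind (finitarization C) S
  contract-finInd⇐ S ((_ , finite⇒ind) , S⊆E∖T) =
    S⊆E∖T , λ F F⊆S finF → contract-Ind⇐ F (finite⇒ind F F⊆S finF , λ x f → S⊆E∖T x (F⊆S x f))

  module Bases = BaseTransfer em (E M) T (Ind M) (Ind C) I2 Ind⊆E Ind-∪T contract-Ind⇒ contract-Ind⇐
  module FinBases = BaseTransfer em (E M) T (Ind (finitarization M)) (Ind (finitarization C))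
    (finInd-down M) (λ _ → proj₁) finInd-∪T contract-finInd⇒ contract-finInd⇐

  -- (I3) for M / T: exchange in M between A ∪ T and B ∪ T; the new element
  -- cannot lie in T, so it comes from B.
  contract-I3 : ∀ A B → Base C B → Ind C A → ¬ Base C A →
                Σ U λ b → (B ∖ A) b × Ind C (A ∪ ｛ b ｝)
  contract-I3 A B baseB indA nonbaseA
    with I3 (A ∪ T) (B ∪ T) (Bases.maximal-∪T B baseB) (Ind-∪T A indM-A) nonbaseA∪T
    where
    indM-A : Ind M A
    indM-A = proj₁ (contract-Ind⇒ A indA)
    nonbaseA∪T : ¬ Base M (A ∪ T)
    nonbaseA∪T baseA∪T = nonbaseA (IsMaximal-resp A⊆A∪T∖T A∪T∖T⊆A indA (Bases.maximal-∖T (A ∪ T) baseA∪T))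
      where
      A⊆A∪T∖T : A ⊆ ((A ∪ T) ∖ T)
      A⊆A∪T∖T x a = inj₁ a , proj₂ (proj₂ (contract-Ind⇒ A indA) x a)
      A∪T∖T⊆A : ((A ∪ T) ∖ T) ⊆ A
      A∪T∖T⊆A x (inj₁ a , _) = a
      A∪T∖T⊆A x (inj₂ t , ¬t) = ⊥-elim (¬t t)
  ... | b , (inj₂ t , b∉A∪T) , _ = ⊥-elim (b∉A∪T (inj₂ t))
  ... | b , (inj₁ b∈B , b∉A∪T) , indA∪T∪b =
    b , (b∈B , λ b∈A → b∉A∪T (inj₁ b∈A)) , contract-Ind⇐ (A ∪ ｛ b ｝) (I2 _ _ indA∪T∪b A∪b⊆ , A∪b⊆E∖T)
    where
    A∪b⊆ : (A ∪ ｛ b ｝) ⊆ ((A ∪ T) ∪ ｛ b ｝)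
    A∪b⊆ x (inj₁ a) = inj₁ (inj₁ a)
    A∪b⊆ x (inj₂ x≡b) = inj₂ x≡b
    A∪b⊆E∖T : (A ∪ ｛ b ｝) ⊆ (E M ∖ T)
    A∪b⊆E∖T x (inj₁ a) = proj₂ (contract-Ind⇒ A indA) x a
    A∪b⊆E∖T x (inj₂ refl) = proj₂ (contract-Ind⇒ B (proj₁ baseB)) b b∈B

  contract-isMatroid : IsMatroid C
  IsMatroid.Ind⊆E contract-isMatroid A indA = proj₁ indA
  IsMatroid.I1 contract-isMatroid = contract-Ind⇐ ∅ (I1 , λ _ ())
  IsMatroid.I2 contract-isMatroid A B indB A⊆B =
    contract-Ind⇐ A (I2 A B (proj₁ (contract-Ind⇒ B indB)) A⊆B ,
                     λ x a → proj₂ (contract-Ind⇒ B indB) x (A⊆B x a))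
  IsMatroid.I3 contract-isMatroid = contract-I3
  -- (I4): a maximal independent set of M between A and X ⊆ E ∖ T avoids T
  IsMatroid.I4 contract-isMatroid A X indA A⊆X X⊆E∖T
    with I4 A X (proj₁ (contract-Ind⇒ A indA)) A⊆X (λ x p → proj₁ (X⊆E∖T x p))
  ... | S , (indS , A⊆S , S⊆X) , max =
    S , (contract-Ind⇐ S (indS , λ x s → X⊆E∖T x (S⊆X x s)) , A⊆S , S⊆X) ,
    λ S′ (indS′ , A⊆S′ , S′⊆X) → max S′ (proj₁ (contract-Ind⇒ S′ indS′) , A⊆S′ , S′⊆X)

  -- For bases B′ ⊆ F′ of M / T and its finitarization, F′ ∖ B′ is
  -- (F′ ∪ T) ∖ (B′ ∪ T), a difference of bases in M.
  nearlyFinitary-contract : NearlyFinitary M → NearlyFinitary C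
  nearlyFinitary-contract nf F′ B′ baseF′ baseB′ B′⊆F′ =
    Finite-mono difference-⊆
      (nf (F′ ∪ T) (B′ ∪ T) (FinBases.maximal-∪T F′ baseF′) (Bases.maximal-∪T B′ baseB′) B′∪T⊆F′∪T)
    where
    B′∪T⊆F′∪T : (B′ ∪ T) ⊆ (F′ ∪ T)
    B′∪T⊆F′∪T x (inj₁ b) = inj₁ (B′⊆F′ x b)
    B′∪T⊆F′∪T x (inj₂ t) = inj₂ t
    difference-⊆ : (F′ ∖ B′) ⊆ ((F′ ∪ T) ∖ (B′ ∪ T))
    difference-⊆ x (f , x∉B′) = inj₁ f , λ where
      (inj₁ b) → x∉B′ b
      (inj₂ t) → proj₂ (proj₁ (proj₁ baseF′) x f) t

  -- For bases B ⊆ F of M and its finitarization, F ∖ B is (F ∖ T) ∖ (B ∖ T),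
  -- a difference of bases in M / T (since T ⊆ B).
  nNearlyFinitary-reflect : ∀ n → NNearlyFinitary n C → NNearlyFinitary n M
  nNearlyFinitary-reflect n nnf F B baseF baseB B⊆F =
    AtMost-mono difference-⊆
      (nnf (F ∖ T) (B ∖ T) (FinBases.maximal-∖T F baseF) (Bases.maximal-∖T B baseB)
           (λ x p → B⊆F x (proj₁ p) , proj₂ p))
    where
    difference-⊆ : (F ∖ B) ⊆ ((F ∖ T) ∖ (B ∖ T))
    difference-⊆ x (f , x∉B) = (f , λ t → x∉B (proj₂ (coloop x t) B baseB)) , λ p → x∉B (proj₁ p)

theorem3p4p8 : ExcludedMiddle (lsuc lzero) →
    {U : Set} (M : SetSystem U) (T : Subset U) →
    IsMatroid M → NearlyFinitary M → (∀ (n : ℕ) → ¬ NNearlyFinitary n M) →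
    (∀ e → T e → IsColoop M e) →
    IsMatroid (contract M T) × NearlyFinitary (contract M T) ×
    (∀ (n : ℕ) → ¬ NNearlyFinitary n (contract M T))
theorem3p4p8 em M T mat nf notNNF coloop =
  contract-isMatroid ,
  nearlyFinitary-contract nf ,
  λ n nnfC → notNNF n (nNearlyFinitary-reflect n nnfC)
  where open ColoopContraction em M T mat coloop
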